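{- Let $\mathcal T$ be a tangle of order $k$ in a connectivity system $(E,\lambda)$. Let $X$ be a $\mathcal T$-strong $k$-separating set, and let $\mathcal F$ be the set of fully closed $k$-separating sets that contain $X$. Then $\bigcap\mathcal F$ is a fully closed $k$-separating set that contains $X$.
   Context: A connectivity system is a pair $(E,\lambda)$ with $E$ finite and $\lambda$ an integer-valued symmetric ($\lambda(X)=\lambda(E-X)$) submodular ($\lambda(X)+\lambda(Y)\ge\lambda(X\cup Y)+\lambda(X\cap Y)$) function on subsets of $E$. $X$ is $k$-separating if $\lambda(X)\le k$. A tangle of order $k$ is a collection $\mathcal T$ of subsets of $E$ with (T1) $\lambda(A)<k$ for $A\in\mathcal T$; (T2) if $\lambda(A)\le k-1$ then $A\in\mathcal T$ or $E-A\in\mathcal T$; (T3) no three members of $\mathcal T$ have union $E$; (T4) $E-\{e\}\notin\mathcal T$ for $e\in E$. $X$ is $\mathcal T$-weak if contained in a member of $\mathcal T$, else $\mathcal T$-strong. A $\mathcal T$-strong $k$-separating set $X$ is fully closed (with respect to $\mathcal T$) if there is no non-empty $\mathcal T$-weak set $Y\subseteq E-X$ such that $X\cup Y$ is $k$-separating. -}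

module Defs where

open import Data.Nat using (ℕ)
open import Data.Fin using (Fin)
open import Data.Fin.Subset using (Subset; _∈_; _∉_; _⊆_; _∪_; _∩_; ∁; ⁅_⁆; Nonempty)
  renaming (⊤ to Full)
open import Data.Integer using (ℤ; _+_; _-_; _≤_; _<_; 1ℤ)
open import Data.Product using (Σ; ∃; _×_; _,_)
open import Data.Sum using (_⊎_)
open import Relation.Nullary using (¬_)
open import Relation.Binary.PropositionalEquality using (_≡_)

-- A connectivity system (E , λ) with ground set E = Fin n,
-- subsets of E represented as Data.Fin.Subset n.
record ConnSystem (n : ℕ) : Set where
  field
    conn       : Subset n → ℤ
    symmetric  : ∀ X → conn X ≡ conn (∁ X)
    submodular : ∀ X Y → conn (X ∪ Y) + conn (X ∩ Y) ≤ conn X + conn Y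
open ConnSystem public

Collection : ℕ → Set₁
Collection n = Subset n → Set

module _ {n : ℕ} (S : ConnSystem n) where

  KSep : ℤ → Subset n → Set
  KSep k X = conn S X ≤ k

  record IsTangle (k : ℤ) (𝒯 : Collection n) : Set where
    field
      T1 : ∀ A → 𝒯 A → conn S A < k
      T2 : ∀ A → conn S A ≤ k - 1ℤ → 𝒯 A ⊎ 𝒯 (∁ A)
      T3 : ∀ A B C → 𝒯 A → 𝒯 B → 𝒯 C → ¬ (A ∪ B ∪ C ≡ Full)
      T4 : ∀ (e : Fin n) → ¬ 𝒯 (∁ ⁅ e ⁆)

  module _ (k : ℤ) (𝒯 : Collection n) where

    Weak : Subset n → Set
    Weak Y = ∃ λ A → 𝒯 A × Y ⊆ A

    Strong : Subset n → Set
    Strong Y = ¬ Weak Y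

    FullyClosed : Subset n → Set
    FullyClosed X =
      Strong X × KSep k X ×
      ¬ (∃ λ Y → Nonempty Y × Weak Y × Y ⊆ ∁ X × KSep k (X ∪ Y))

module Submission where

-- Starting from X, repeatedly enlarge the current set S′ by a
-- non-empty 𝒯-weak set Y ⊆ E − S′ with S′ ∪ Y still k-separating, until no
-- such Y exists; the final set I is then fully closed by definition.  The
-- invariant of this closure procedure is that S′ lies inside every fully
-- closed F ⊇ X; it is preserved by the absorption lemma: a fully closed F
-- contains every k-separating Z for which Z ∩ F is 𝒯-strong and Z − F is
-- 𝒯-weak (proved by uncrossing Z and F with submodularity, and by axiom T2
-- when λ(Z ∩ F) < k).  Hence I is the least fully closed set containing X,
-- i.e. the intersection of all of them.
--
-- Constructively, the procedure needs to decide whether S′ can be enlarged;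
-- this holds because tangle membership is decidable (T1–T3) and subsets of
-- a finite set can be searched.  Each step shrinks E − S′, so it terminates.

open import Defs
open import Data.Nat using (ℕ)
open import Data.Fin using (Fin)
open import Data.Fin.Subset using (Subset; _∈_; _⊆_)
open import Data.Integer using (ℤ)
open import Data.Product using (∃; _×_; _,_)
open import Function.Bundles using (_⇔_; mk⇔)

import Data.Nat as ℕ
import Data.Nat.Properties as ℕₚ
open import Data.Fin.Subset using (_∪_; _∩_; ∁; Nonempty; ⊤; ⊥; ∣_∣; _⊂_)
open import Data.Fin.Subset.Properties
open import Data.Integer using (_+_; _-_; _≤_; _<_; 1ℤ; -_)
open import Data.Integer.Properties
  using (≤-trans; _≤?_; +-comm; i<j⇒i≤pred[j]; ≮⇒≥; ≤⇒≯; +-mono-≤; +-mono-<-≤; +-mono-<)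
open import Data.Sum using (inj₁; inj₂)
open import Data.Empty using (⊥-elim)
open import Relation.Nullary using (¬_; Dec; yes; no)
open import Relation.Nullary.Decidable using (_×-dec_)
open import Relation.Binary.PropositionalEquality
  using (_≡_; sym; trans; cong; cong₂; subst; subst₂; module ≡-Reasoning)

half-≤ : ∀ {a b : ℤ} → a + a ≤ b + b → a ≤ b
half-≤ a+a≤b+b = ≮⇒≥ (λ b<a → ≤⇒≯ a+a≤b+b (+-mono-< b<a b<a))

<⇒≤-1 : ∀ {c k : ℤ} → c < k → c ≤ k - 1ℤ
<⇒≤-1 {c} {k} c<k = subst (c ≤_) (+-comm (- 1ℤ) k) (i<j⇒i≤pred[j] c<k)

≰-1⇒≥ : ∀ {c k : ℤ} → ¬ (c ≤ k - 1ℤ) → k ≤ c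
≰-1⇒≥ c≰k-1 = ≮⇒≥ (λ c<k → c≰k-1 (<⇒≤-1 c<k))

bound-by-sum : ∀ {x c k : ℤ} → x + c ≤ k + k → k ≤ c → x ≤ k
bound-by-sum x+c≤2k k≤c = ≮⇒≥ (λ k<x → ≤⇒≯ x+c≤2k (+-mono-<-≤ k<x k≤c))

∁⊥≡⊤ : ∀ {n} → ∁ ⊥ ≡ ⊤ {n}
∁⊥≡⊤ = trans (sym (∪-identityˡ (∁ ⊥))) (p∪∁p≡⊤ ⊥)

-- A set together with its complement (twice) covers E; this is what rules
-- out A and E − A belonging to the same tangle (T3).
covered-by-complement : ∀ {n} (A : Subset n) → A ∪ ∁ A ∪ ∁ A ≡ ⊤
covered-by-complement A = trans (cong (A ∪_) (∪-idem (∁ A))) (p∪∁p≡⊤ A)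

union-split : ∀ {n} (Z F : Subset n) → Z ∪ F ≡ F ∪ (Z ∩ ∁ F)
union-split Z F = begin
  Z ∪ F                   ≡⟨ ∪-comm Z F ⟩
  F ∪ Z                   ≡⟨ ∩-identityʳ (F ∪ Z) ⟨
  (F ∪ Z) ∩ ⊤             ≡⟨ cong ((F ∪ Z) ∩_) (p∪∁p≡⊤ F) ⟨
  (F ∪ Z) ∩ (F ∪ ∁ F)     ≡⟨ ∪-distribˡ-∩ F Z (∁ F) ⟨
  F ∪ (Z ∩ ∁ F)           ∎
  where open ≡-Reasoning

complement-shrinks : ∀ {n} {S′ Y : Subset n} →
  Nonempty Y → Y ⊆ ∁ S′ → ∣ ∁ (S′ ∪ Y) ∣ ℕ.< ∣ ∁ S′ ∣
complement-shrinks {S′ = S′} {Y} (y , y∈Y) Y⊆∁S′ =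
  p⊂q⇒∣p∣<∣q∣ (p⊂q⇒∁p⊃∁q S′⊂S′∪Y)
  where
  S′⊂S′∪Y : S′ ⊂ S′ ∪ Y
  S′⊂S′∪Y = p⊆p∪q Y , y , x∈p∪q⁺ (inj₂ y∈Y) , x∈∁p⇒x∉p (Y⊆∁S′ y∈Y)

module _ {n : ℕ} (S : ConnSystem n) where

  -- The whole ground set has the least connectivity:
  -- λ(E) + λ(∅) ≤ λ(A) + λ(E − A), with λ(∅) = λ(E) and λ(E − A) = λ(A).
  conn-⊤-least : ∀ A → conn S ⊤ ≤ conn S A
  conn-⊤-least A = half-≤ (subst₂ _≤_ (cong₂ _+_ λ[A∪∁A] λ[A∩∁A]) λ[A]+λ[∁A]
                                    (submodular S A (∁ A)))
    where
    λ[A∪∁A] : conn S (A ∪ ∁ A) ≡ conn S ⊤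
    λ[A∪∁A] = cong (conn S) (p∪∁p≡⊤ A)
    λ[A∩∁A] : conn S (A ∩ ∁ A) ≡ conn S ⊤
    λ[A∩∁A] = trans (cong (conn S) (∩-inverseʳ A))
                    (trans (symmetric S ⊥) (cong (conn S) ∁⊥≡⊤))
    λ[A]+λ[∁A] : conn S A + conn S (∁ A) ≡ conn S A + conn S A
    λ[A]+λ[∁A] = cong (conn S A +_) (sym (symmetric S A))

  uncross : ∀ {k} Z F → KSep S k Z → KSep S k F →
            ¬ (conn S (Z ∩ F) ≤ k - 1ℤ) → KSep S k (Z ∪ F)
  uncross Z F sepZ sepF large =
    bound-by-sum (≤-trans (submodular S Z F) (+-mono-≤ sepZ sepF)) (≰-1⇒≥ large)

module _ {n : ℕ} (S : ConnSystem n) (k : ℤ) (𝒯 : Collection n) where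

  weak-⊆ : ∀ {A B} → A ⊆ B → Weak S k 𝒯 B → Weak S k 𝒯 A
  weak-⊆ A⊆B (C , C∈𝒯 , B⊆C) = C , C∈𝒯 , ⊆-trans A⊆B B⊆C

  strong-⊇ : ∀ {A B} → A ⊆ B → Strong S k 𝒯 A → Strong S k 𝒯 B
  strong-⊇ A⊆B strongA weakB = strongA (weak-⊆ A⊆B weakB)

  Enlargement : Subset n → Set
  Enlargement S′ = ∃ λ Y → Nonempty Y × Weak S k 𝒯 Y × Y ⊆ ∁ S′ × KSep S k (S′ ∪ Y)

module Tangle {n : ℕ} (S : ConnSystem n) (k : ℤ) (𝒯 : Collection n)
              (T : IsTangle S k 𝒯) where

  open IsTangle T

  -- Membership in a tangle is decidable: a member has λ < k (T1); if
  -- λ(A) ≤ k − 1 then A or E − A is a member (T2), but not both (T3).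
  member? : ∀ A → Dec (𝒯 A)
  member? A with conn S A ≤? k - 1ℤ
  ... | no  large = no (λ A∈𝒯 → large (<⇒≤-1 (T1 A A∈𝒯)))
  ... | yes small with T2 A small
  ...   | inj₁ A∈𝒯  = yes A∈𝒯
  ...   | inj₂ ∁A∈𝒯 = no (λ A∈𝒯 → T3 A (∁ A) (∁ A) A∈𝒯 ∁A∈𝒯 ∁A∈𝒯 (covered-by-complement A))

  weak? : ∀ Y → Dec (Weak S k 𝒯 Y)
  weak? Y = anySubset? (λ A → member? A ×-dec (Y ⊆? A))

  enlargement? : ∀ S′ → Dec (Enlargement S k 𝒯 S′)
  enlargement? S′ = anySubset? (λ Y →
    nonempty? Y ×-dec weak? Y ×-dec (Y ⊆? ∁ S′) ×-dec (conn S (S′ ∪ Y) ≤? k))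

  -- An element of Z − F would yield an
  -- enlargement of F: Z − F itself if λ(Z ∩ F) ≥ k (by uncrossing), and
  -- E − F otherwise (T2 puts E − (Z ∩ F) ⊇ E − F in 𝒯, and λ(E) ≤ λ(F)).
  absorb : ∀ F → FullyClosed S k 𝒯 F → ∀ Z → KSep S k Z →
           Strong S k 𝒯 (Z ∩ F) → Weak S k 𝒯 (Z ∩ ∁ F) → Z ⊆ F
  absorb F (_ , sepF , closedF) Z sepZ strongZ∩F weakZ∖F {e} e∈Z with e ∈? F
  ... | yes e∈F = e∈F
  ... | no  e∉F = ⊥-elim (closedF enlargement)
    where
    e∈∁F : e ∈ ∁ F
    e∈∁F = x∉p⇒x∈∁p e∉F

    enlargement : Enlargement S k 𝒯 F
    enlargement with conn S (Z ∩ F) ≤? k - 1ℤ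
    ... | no large =
      Z ∩ ∁ F , (e , x∈p∩q⁺ (e∈Z , e∈∁F)) , weakZ∖F , p∩q⊆q Z (∁ F) ,
      subst (KSep S k) (union-split Z F) (uncross S Z F sepZ sepF large)
    ... | yes small with T2 (Z ∩ F) small
    ...   | inj₁ Z∩F∈𝒯  = ⊥-elim (strongZ∩F (Z ∩ F , Z∩F∈𝒯 , λ x → x))
    ...   | inj₂ ∁Z∩F∈𝒯 =
      ∁ F , (e , e∈∁F) , (∁ (Z ∩ F) , ∁Z∩F∈𝒯 , p⊆q⇒∁p⊇∁q (p∩q⊆q Z F)) , (λ x → x) ,
      subst (KSep S k) (sym (p∪∁p≡⊤ F)) (≤-trans (conn-⊤-least S F) sepF)

  module Closure (X : Subset n) (strongX : Strong S k 𝒯 X) where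

    BelowAll : Subset n → Set
    BelowAll S′ = ∀ F → FullyClosed S k 𝒯 F → X ⊆ F → S′ ⊆ F

    -- Enlarging S′ ⊇ X preserves the invariant: by absorption, since
    -- (S′ ∪ Y) ∩ F ⊇ X is strong and (S′ ∪ Y) − F ⊆ Y is weak.
    enlarge-belowAll : ∀ {S′ Y} → X ⊆ S′ → BelowAll S′ → Weak S k 𝒯 Y →
                       KSep S k (S′ ∪ Y) → BelowAll (S′ ∪ Y)
    enlarge-belowAll {S′} {Y} X⊆S′ below weakY sepS′∪Y F closedF X⊆F =
      absorb F closedF (S′ ∪ Y) sepS′∪Y
        (strong-⊇ S k 𝒯 (λ x∈X → x∈p∩q⁺ (p⊆p∪q Y (X⊆S′ x∈X) , X⊆F x∈X)) strongX)
        (weak-⊆ S k 𝒯 outside⊆Y weakY)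
      where
      outside⊆Y : (S′ ∪ Y) ∩ ∁ F ⊆ Y
      outside⊆Y x∈ with x∈p∩q⁻ (S′ ∪ Y) (∁ F) x∈
      ... | x∈S′∪Y , x∈∁F with x∈p∪q⁻ S′ Y x∈S′∪Y
      ...   | inj₁ x∈S′ = ⊥-elim (x∈∁p⇒x∉p x∈∁F (below F closedF X⊆F x∈S′))
      ...   | inj₂ x∈Y  = x∈Y

    LeastFullyClosed : Set
    LeastFullyClosed = ∃ λ I → X ⊆ I × FullyClosed S k 𝒯 I × BelowAll I

    close : ∀ fuel S′ → ∣ ∁ S′ ∣ ℕ.< fuel →
            X ⊆ S′ → KSep S k S′ → BelowAll S′ → LeastFullyClosed
    close (ℕ.suc fuel) S′ bound X⊆S′ sepS′ below with enlargement? S′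
    ... | no  closed = S′ , X⊆S′ , (strong-⊇ S k 𝒯 X⊆S′ strongX , sepS′ , closed) , below
    ... | yes (Y , nonemptyY , weakY , Y⊆∁S′ , sepS′∪Y) =
      close fuel (S′ ∪ Y)
        (ℕₚ.<-≤-trans (complement-shrinks nonemptyY Y⊆∁S′) (ℕ.s≤s⁻¹ bound))
        (⊆-trans X⊆S′ (p⊆p∪q Y)) sepS′∪Y (enlarge-belowAll X⊆S′ below weakY sepS′∪Y)

    leastFullyClosed : KSep S k X → LeastFullyClosed
    leastFullyClosed sepX =
      close (ℕ.suc ∣ ∁ X ∣) X ℕₚ.≤-refl (λ x∈X → x∈X) sepX (λ _ _ X⊆F → X⊆F)

least-is-intersection : ∀ {n} (P Q : Subset n → Set) (I : Subset n) →
  P I → Q I → (∀ F → P F → Q F → I ⊆ F) →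
  ∀ e → (e ∈ I ⇔ (∀ F → P F → Q F → e ∈ F))
least-is-intersection P Q I PI QI least e =
  mk⇔ (λ e∈I F PF QF → least F PF QF e∈I) (λ e∈all → e∈all I PI QI)

corollary3p2 : ∀ {n : ℕ} (S : ConnSystem n) (k : ℤ) (𝒯 : Collection n) →
    IsTangle S k 𝒯 →
    (X : Subset n) → Strong S k 𝒯 X → KSep S k X →
    ∃ λ (I : Subset n) →
    (∀ (e : Fin n) → (e ∈ I ⇔ (∀ (F : Subset n) → FullyClosed S k 𝒯 F → X ⊆ F → e ∈ F)))
    × FullyClosed S k 𝒯 I × X ⊆ I
corollary3p2 S k 𝒯 T X strongX sepX
  with Tangle.Closure.leastFullyClosed S k 𝒯 T X strongX sepX
... | I , X⊆I , closedI , belowAll =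
  I , least-is-intersection (FullyClosed S k 𝒯) (X ⊆_) I closedI (λ {x} → X⊆I {x})
                            (λ F closedF X⊆F {x} → belowAll F closedF X⊆F {x})
    , closedI , X⊆I
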